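{- If a defeasible logic is well-disciplined, then it is well-behaved.
   Context: A defeasible theory $D=(F,R,>)$ consists of a finite set $F$ of literals, a finite set $R$ of rules (each with a finite antecedent set of literals, a type strict/defeasible/defeater and a consequent literal) and an acyclic relation $>$ on $R$. Conclusions have the form $+d\,q$ or $-d\,q$. A defeasible logic is a finite set of inference rules "We may append $\pm d\,q$ to $P$ if $C$", one per tag; a proof from $D$ is a finite sequence of conclusions each appendable by some rule to the sequence preceding it. An applicability condition $C(D,q,P)$ is a first-order formula in negation normal form (negation only on atomic formulas; connectives $\wedge,\vee,\exists,\forall$) whose atomic formulas are pure atomic formulas (comparisons of elements of $D$, arithmetic and set comparisons; no tagged literals, no $P$) or proof atomic formulas $\pm d'p\in X$ with $X$ either the current proof $P$ or a pre-defined set of conclusions (a closure, as below); $c\notin X$ abbreviates $\neg(c\in X)$. $C$ is $P$-disciplined if $P$ occurs in $C$ only in expressions $\pm d'p\in P$, each in positive context (not under $\neg$). Strong negation: $\mathrm{sneg}(+d p\in X)= -dp\in X$; $\mathrm{sneg}(-dp\in X)=+dp\in X$; $\mathrm{sneg}(+dp\notin X)=+dp\in X$; $\mathrm{sneg}(-dp\notin X)=-dp\in X$; $\mathrm{sneg}(A\wedge B)=\mathrm{sneg}(A)\vee\mathrm{sneg}(B)$; $\mathrm{sneg}(A\vee B)=\mathrm{sneg}(A)\wedge\mathrm{sneg}(B)$; $\mathrm{sneg}(\exists x\,A)=\forall x\,\mathrm{sneg}(A)$; $\mathrm{sneg}(\forall x\,A)=\exists x\,\mathrm{sneg}(A)$;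 $\mathrm{sneg}(\neg A)=A$ and $\mathrm{sneg}(A)=\neg A$ for pure atomic $A$. The logic supports the (revised) Principle of Strong Negation if for every tag $d$, when the $+d$ rule has condition $C$, the $-d$ rule has condition $\mathrm{sneg}(C)$. An inference rule is stable if for every proof $P$ and every proof $Q$ containing $P$ as a subsequence, $C(P)\rightarrow C(Q)$. A set $I$ of rules is reference-closed if whenever a rule in $I$ refers to a conclusion with tag $t$, the rule for $t$ is in $I$. For a set $J$ of rules with $I$ the smallest reference-closed set containing $J$, the $J$-closure is the set of conclusions with tags in $J$ in the smallest set of conclusions closed under inference by rules of $I$; it involves a rule $d$ if $d\in I$; it is even-handed if $J$ contains the $-d$ rule iff it contains the $+d$ rule. A set of conclusions is coherent if it contains no pair $+dq,-dq$. A closure stratification is a map $m$ from tags to natural numbers such that $m(d)\ge m(d')$ whenever a rule for $+d$ or $-d$ refers to $+d'$ or $-d'$, and $m(d)>m(d')$ whenever a rule for $+d$ or $-d$ refers to a closure that involves $d'$; the logic is closure stratified if it has one. The logic is well-disciplined if it is closure stratified, every inference rule has a $P$-disciplined applicability condition, it supports the revised Principle of Strong Negation, and all pre-defined sets in its inference rules are even-handed closures. The logic is well-behaved if all its rules are stable, it supports the revised Principle of Strong Negation, and all pre-defined sets in its inference rules are coherent even-handed closures. -}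

module Defs where

open import Data.Nat using (ℕ; _≤_; _<_)
open import Data.Bool using (Bool; true; false)
open import Data.Fin using (Fin)
open import Data.List using (List; []; _∷ʳ_)
open import Data.List.Membership.Propositional using (_∈_)
open import Data.List.Relation.Binary.Sublist.Propositional using (_⊆_)
open import Data.Product using (Σ; _×_; _,_)
open import Data.Sum using (_⊎_)
open import Relation.Nullary using (¬_)
open import Relation.Binary.PropositionalEquality using (_≡_)
open import Relation.Binary.Construct.Closure.Transitive using (TransClosure)

data Lit : Set where
  atm  : ℕ → Lit
  natm : ℕ → Lit

data RuleType : Set where
  strict defeasible defeater : RuleType

record DRule : Set where
  field
    ante : List Lit
    type : RuleType
    head : Lit

-- the rules of a theory are indexed by Fin nR; > is a relation on them
record Theory : Set₁ where
  field
    facts   : List Lit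
    nR      : ℕ
    rules   : Fin nR → DRule
    sup     : Fin nR → Fin nR → Set
    acyclic : ∀ i → ¬ TransClosure sup i i

data Sign : Set where
  ⊕ ⊖ : Sign

record Conc (k : ℕ) : Set where
  constructor conc
  field
    sign : Sign
    tag  : Fin k
    lit  : Lit

-- Applicability conditions: first-order formulas in negation normal form.
-- k = number of tags, n = number of pre-defined sets (closures).
-- Quantifiers are higher-order abstract syntax; pure atomic formulas are
-- arbitrary propositions not mentioning proofs (given by 'pure A',
-- negated 'npure A').

data Form (k n : ℕ) : Set₁ where
  pure npure   : Set → Form k n
  inP notInP   : Conc k → Form k n
  inX notInX   : Fin n → Conc k → Form k n
  _∧_ _∨_      : Form k n → Form k n → Form k n
  ex all       : {A : Set} → (A → Form k n) → Form k n

flip : Sign → Sign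
flip ⊕ = ⊖
flip ⊖ = ⊕

negC : ∀ {k} → Conc k → Conc k
negC (conc s d p) = conc (flip s) d p

sneg : ∀ {k n} → Form k n → Form k n
sneg (pure A)     = npure A
sneg (npure A)    = pure A
sneg (inP c)      = inP (negC c)
sneg (notInP c)   = inP c
sneg (inX x c)    = inX x (negC c)
sneg (notInX x c) = inX x c
sneg (φ ∧ ψ)      = sneg φ ∨ sneg ψ
sneg (φ ∨ ψ)      = sneg φ ∧ sneg ψ
sneg (ex f)       = all (λ a → sneg (f a))
sneg (all f)      = ex (λ a → sneg (f a))

⟦_⟧ : ∀ {k n} → Form k n → (Conc k → Set) → (Fin n → Conc k → Set) → Set
⟦ pure A ⟧ P X = A
⟦ npure A ⟧ P X = ¬ A
⟦ inP c ⟧ P X = P c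
⟦ notInP c ⟧ P X = ¬ P c
⟦ inX x c ⟧ P X = X x c
⟦ notInX x c ⟧ P X = ¬ X x c
⟦ φ ∧ ψ ⟧ P X = ⟦ φ ⟧ P X × ⟦ ψ ⟧ P X
⟦ φ ∨ ψ ⟧ P X = ⟦ φ ⟧ P X ⊎ ⟦ ψ ⟧ P X
⟦ ex {A} f ⟧ P X = Σ A (λ a → ⟦ f a ⟧ P X)
⟦ all {A} f ⟧ P X = (a : A) → ⟦ f a ⟧ P X

data PDisc {k n} : Form k n → Set₁ where
  pure   : ∀ A → PDisc (pure A)
  npure  : ∀ A → PDisc (npure A)
  inP    : ∀ c → PDisc (inP c)
  inX    : ∀ x c → PDisc (inX x c)
  notInX : ∀ x c → PDisc (notInX x c)
  _∧_    : ∀ {φ ψ} → PDisc φ → PDisc ψ → PDisc (φ ∧ ψ)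
  _∨_    : ∀ {φ ψ} → PDisc φ → PDisc ψ → PDisc (φ ∨ ψ)
  ex     : ∀ {A} {f : A → Form k n} → (∀ a → PDisc (f a)) → PDisc (ex f)
  all    : ∀ {A} {f : A → Form k n} → (∀ a → PDisc (f a)) → PDisc (all f)

data RefTag {k n} (s : Sign) (d : Fin k) : Form k n → Set₁ where
  inP    : ∀ p → RefTag s d (inP (conc s d p))
  notInP : ∀ p → RefTag s d (notInP (conc s d p))
  ∧ˡ : ∀ {φ ψ} → RefTag s d φ → RefTag s d (φ ∧ ψ)
  ∧ʳ : ∀ {φ ψ} → RefTag s d ψ → RefTag s d (φ ∧ ψ)
  ∨ˡ : ∀ {φ ψ} → RefTag s d φ → RefTag s d (φ ∨ ψ)
  ∨ʳ : ∀ {φ ψ} → RefTag s d ψ → RefTag s d (φ ∨ ψ)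
  ex  : ∀ {A} {f : A → Form k n} (a : A) → RefTag s d (f a) → RefTag s d (ex f)
  all : ∀ {A} {f : A → Form k n} (a : A) → RefTag s d (f a) → RefTag s d (all f)

data RefSet {k n} (x : Fin n) : Form k n → Set₁ where
  inX    : ∀ c → RefSet x (inX x c)
  notInX : ∀ c → RefSet x (notInX x c)
  ∧ˡ : ∀ {φ ψ} → RefSet x φ → RefSet x (φ ∧ ψ)
  ∧ʳ : ∀ {φ ψ} → RefSet x ψ → RefSet x (φ ∧ ψ)
  ∨ˡ : ∀ {φ ψ} → RefSet x φ → RefSet x (φ ∨ ψ)
  ∨ʳ : ∀ {φ ψ} → RefSet x ψ → RefSet x (φ ∨ ψ)
  ex  : ∀ {A} {f : A → Form k n} (a : A) → RefSet x (f a) → RefSet x (ex f)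
  all : ∀ {A} {f : A → Form k n} (a : A) → RefSet x (f a) → RefSet x (all f)

-- A defeasible logic with k tags and n pre-defined sets.
-- cond s d D q is the applicability condition C(D,q,P) of the rule for  s d .
-- Each pre-defined set x is (intended to be) the J x - closure; its
-- extension for the theory D is setX x D.

record Logic (k n : ℕ) : Set₁ where
  field
    cond : Sign → Fin k → Theory → Lit → Form k n
    J    : Fin n → Sign → Fin k → Bool
    setX : Fin n → Theory → Conc k → Set

module _ {k n : ℕ} (L : Logic k n) where
  open Logic L

  RefersTag : Sign → Fin k → Sign → Fin k → Set₁
  RefersTag s d s' d' = Σ Theory λ D → Σ Lit λ q → RefTag s' d' (cond s d D q)

  RefersSet : Sign → Fin k → Fin n → Set₁
  RefersSet s d x = Σ Theory λ D → Σ Lit λ q → RefSet x (cond s d D q)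

  data InI (x : Fin n) : Sign → Fin k → Set₁ where
    base : ∀ {s d} → J x s d ≡ true → InI x s d
    step : ∀ {s d s' d'} → InI x s d → RefersTag s d s' d' → InI x s' d'

  Involves : Fin n → Sign → Fin k → Set₁
  Involves = InI

  ClosedUnder : Fin n → Theory → (Conc k → Set) → Set₁
  ClosedUnder x D S = ∀ s d q → InI x s d →
    ⟦ cond s d D q ⟧ S (λ y → setX y D) → S (conc s d q)

  IsClosure : Fin n → Set₁
  IsClosure x = ∀ D c →
    (setX x D c → (J x (Conc.sign c) (Conc.tag c) ≡ true) ×
                  (∀ (S : Conc k → Set) → ClosedUnder x D S → S c)) ×
    ((J x (Conc.sign c) (Conc.tag c) ≡ true) ×
       (∀ (S : Conc k → Set) → ClosedUnder x D S → S c) → setX x D c)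

  EvenHanded : Fin n → Set
  EvenHanded x = ∀ d → J x ⊕ d ≡ J x ⊖ d

  Coherent : Fin n → Set₁
  Coherent x = ∀ D d q → ¬ (setX x D (conc ⊕ d q) × setX x D (conc ⊖ d q))

  Appendable : Theory → List (Conc k) → Conc k → Set
  Appendable D P (conc s d q) = ⟦ cond s d D q ⟧ (_∈ P) (λ y → setX y D)

  data IsProof (D : Theory) : List (Conc k) → Set where
    []  : IsProof D []
    snoc : ∀ {P c} → IsProof D P → Appendable D P c → IsProof D (P ∷ʳ c)

  Stable : Sign → Fin k → Set₁
  Stable s d = ∀ D q (P Q : List (Conc k)) → IsProof D P → IsProof D Q → P ⊆ Q →
    ⟦ cond s d D q ⟧ (_∈ P) (λ y → setX y D) →
    ⟦ cond s d D q ⟧ (_∈ Q) (λ y → setX y D)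

  StrongNegation : Set₁
  StrongNegation = ∀ d D q → cond ⊖ d D q ≡ sneg (cond ⊕ d D q)

  ClosureStratification : (Fin k → ℕ) → Set₁
  ClosureStratification m =
    (∀ s d s' d' → RefersTag s d s' d' → m d' ≤ m d) ×
    (∀ s d x s' d' → RefersSet s d x → Involves x s' d' → m d' < m d)

  ClosureStratified : Set₁
  ClosureStratified = Σ (Fin k → ℕ) ClosureStratification

  WellDisciplined : Set₁
  WellDisciplined =
    ClosureStratified ×
    (∀ s d D q → PDisc (cond s d D q)) ×
    StrongNegation ×
    (∀ x → IsClosure x × EvenHanded x)

  WellBehaved : Set₁
  WellBehaved =
    (∀ s d → Stable s d) ×
    StrongNegation ×
    (∀ x → Coherent x × IsClosure x × EvenHanded x)

module Submission where

-- Stability is monotonicity of P-disciplined conditions in P.  For coherence,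
-- let Derivable be the least set of conclusions closed under all the rules;
-- every closure lies inside it, so it suffices that Derivable is coherent.  If
-- +d q and -d q were both derivable, the condition C of +d and sneg C would
-- hold together, hence clash on an atom: on a pair ±d'p ∈ P, where m d' ≤ m d,
-- the clash is excluded by induction on derivations; on a pair ±d'p ∈ X, the
-- closure X only involves rules strictly below d, and the clash is excluded by
-- induction on the stratum.

open import Defs
open import Data.Nat using (ℕ; zero; suc; _<_)
open import Data.Nat.Properties using (≤-<-trans; <-≤-trans; ≤-pred; n<1+n)
open import Data.Fin using (Fin)
open import Data.Product using (Σ; _×_; _,_; proj₁; proj₂)
open import Data.Sum using (_⊎_; inj₁; inj₂)
open import Data.Empty using (⊥)
open import Relation.Nullary using (¬_)
open import Relation.Binary.PropositionalEquality using (_≡_; refl; sym; subst)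
open import Data.List.Relation.Binary.Sublist.Propositional.Properties using (Any-resp-⊆)

-- The semantics of P-disciplined formulas, reading the excluded  c ∉ P  as ⊥:
-- P then occurs strictly positively, so Derivable below can be inductive.
⟦_⟧⁺ : ∀ {k n} → Form k n → (Conc k → Set) → (Fin n → Conc k → Set) → Set
⟦ pure A ⟧⁺ P X = A
⟦ npure A ⟧⁺ P X = ¬ A
⟦ inP c ⟧⁺ P X = P c
⟦ notInP c ⟧⁺ P X = ⊥
⟦ inX x c ⟧⁺ P X = X x c
⟦ notInX x c ⟧⁺ P X = ¬ X x c
⟦ φ ∧ ψ ⟧⁺ P X = ⟦ φ ⟧⁺ P X × ⟦ ψ ⟧⁺ P X
⟦ φ ∨ ψ ⟧⁺ P X = ⟦ φ ⟧⁺ P X ⊎ ⟦ ψ ⟧⁺ P X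
⟦ ex {A} f ⟧⁺ P X = Σ A λ a → ⟦ f a ⟧⁺ P X
⟦ all {A} f ⟧⁺ P X = (a : A) → ⟦ f a ⟧⁺ P X

flip-involutive : ∀ s → flip (flip s) ≡ s
flip-involutive ⊕ = refl
flip-involutive ⊖ = refl

module _ {k n : ℕ} {X : Fin n → Conc k → Set} where

  ⟦⟧⇒⟦⟧⁺ : ∀ {φ : Form k n} {P} → PDisc φ → ⟦ φ ⟧ P X → ⟦ φ ⟧⁺ P X
  ⟦⟧⇒⟦⟧⁺ (pure A) a = a
  ⟦⟧⇒⟦⟧⁺ (npure A) a = a
  ⟦⟧⇒⟦⟧⁺ (inP c) a = a
  ⟦⟧⇒⟦⟧⁺ (inX x c) a = a
  ⟦⟧⇒⟦⟧⁺ (notInX x c) a = a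
  ⟦⟧⇒⟦⟧⁺ (φ ∧ ψ) (a , b) = ⟦⟧⇒⟦⟧⁺ φ a , ⟦⟧⇒⟦⟧⁺ ψ b
  ⟦⟧⇒⟦⟧⁺ (φ ∨ ψ) (inj₁ a) = inj₁ (⟦⟧⇒⟦⟧⁺ φ a)
  ⟦⟧⇒⟦⟧⁺ (φ ∨ ψ) (inj₂ b) = inj₂ (⟦⟧⇒⟦⟧⁺ ψ b)
  ⟦⟧⇒⟦⟧⁺ (ex f) (a , b) = a , ⟦⟧⇒⟦⟧⁺ (f a) b
  ⟦⟧⇒⟦⟧⁺ (all f) g = λ a → ⟦⟧⇒⟦⟧⁺ (f a) (g a)

  PDisc-mono : ∀ {φ : Form k n} {P Q : Conc k → Set} → PDisc φ →
               (∀ {c} → P c → Q c) → ⟦ φ ⟧ P X → ⟦ φ ⟧ Q X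
  PDisc-mono (pure A) P⊆Q a = a
  PDisc-mono (npure A) P⊆Q a = a
  PDisc-mono (inP c) P⊆Q a = P⊆Q a
  PDisc-mono (inX x c) P⊆Q a = a
  PDisc-mono (notInX x c) P⊆Q a = a
  PDisc-mono (φ ∧ ψ) P⊆Q (a , b) = PDisc-mono φ P⊆Q a , PDisc-mono ψ P⊆Q b
  PDisc-mono (φ ∨ ψ) P⊆Q (inj₁ a) = inj₁ (PDisc-mono φ P⊆Q a)
  PDisc-mono (φ ∨ ψ) P⊆Q (inj₂ b) = inj₂ (PDisc-mono ψ P⊆Q b)
  PDisc-mono (ex f) P⊆Q (a , b) = a , PDisc-mono (f a) P⊆Q b
  PDisc-mono (all f) P⊆Q g = λ a → PDisc-mono (f a) P⊆Q (g a)

  sneg-excludes : ∀ (φ : Form k n) {P Q : Conc k → Set} →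
    (∀ {s d} → RefTag s d φ → ∀ p → P (conc s d p) → Q (conc (flip s) d p) → ⊥) →
    (∀ {x} → RefSet x φ → ∀ c → X x c → X x (negC c) → ⊥) →
    ⟦ φ ⟧⁺ P X → ⟦ sneg φ ⟧⁺ Q X → ⊥
  sneg-excludes (pure A) pq xx a ¬a = ¬a a
  sneg-excludes (npure A) pq xx ¬a a = ¬a a
  sneg-excludes (inP (conc s d p)) pq xx a b = pq (inP p) p a b
  sneg-excludes (inX x c) pq xx a b = xx (inX c) c a b
  sneg-excludes (notInX x c) pq xx ¬a a = ¬a a
  sneg-excludes (φ ∧ ψ) pq xx (a , _) (inj₁ b) =
    sneg-excludes φ (λ r → pq (∧ˡ r)) (λ r → xx (∧ˡ r)) a b
  sneg-excludes (φ ∧ ψ) pq xx (_ , a) (inj₂ b) =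
    sneg-excludes ψ (λ r → pq (∧ʳ r)) (λ r → xx (∧ʳ r)) a b
  sneg-excludes (φ ∨ ψ) pq xx (inj₁ a) (b , _) =
    sneg-excludes φ (λ r → pq (∨ˡ r)) (λ r → xx (∨ˡ r)) a b
  sneg-excludes (φ ∨ ψ) pq xx (inj₂ a) (_ , b) =
    sneg-excludes ψ (λ r → pq (∨ʳ r)) (λ r → xx (∨ʳ r)) a b
  sneg-excludes (ex f) pq xx (a , fa) g =
    sneg-excludes (f a) (λ r → pq (ex a r)) (λ r → xx (ex a r)) fa (g a)
  sneg-excludes (all f) pq xx g (a , fa) =
    sneg-excludes (f a) (λ r → pq (all a r)) (λ r → xx (all a r)) (g a) fa

module Derivation {k n : ℕ} (L : Logic k n) (D : Theory) where
  open Logic L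

  X : Fin n → Conc k → Set
  X x = setX x D

  data Derivable : Conc k → Set where
    derive : ∀ s d q → ⟦ cond s d D q ⟧⁺ Derivable X → Derivable (conc s d q)

  module _ (M : Conc k → Set)
           (M-closed : ∀ s d q → ⟦ cond s d D q ⟧⁺ M X → M (conc s d q)) where

    Derivable-least : ∀ {c} → Derivable c → M c
    ⟦⟧⁺-least : ∀ φ → ⟦ φ ⟧⁺ Derivable X → ⟦ φ ⟧⁺ M X

    Derivable-least (derive s d q h) = M-closed s d q (⟦⟧⁺-least (cond s d D q) h)

    ⟦⟧⁺-least (pure A) a = a
    ⟦⟧⁺-least (npure A) a = a
    ⟦⟧⁺-least (inP c) a = Derivable-least a
    ⟦⟧⁺-least (inX x c) a = a
    ⟦⟧⁺-least (notInX x c) a = a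
    ⟦⟧⁺-least (φ ∧ ψ) (a , b) = ⟦⟧⁺-least φ a , ⟦⟧⁺-least ψ b
    ⟦⟧⁺-least (φ ∨ ψ) (inj₁ a) = inj₁ (⟦⟧⁺-least φ a)
    ⟦⟧⁺-least (φ ∨ ψ) (inj₂ b) = inj₂ (⟦⟧⁺-least ψ b)
    ⟦⟧⁺-least (ex f) (a , b) = a , ⟦⟧⁺-least (f a) b
    ⟦⟧⁺-least (all f) g = λ a → ⟦⟧⁺-least (f a) (g a)

  module _ (disciplined : ∀ s d D q → PDisc (cond s d D q)) where

    Derivable-closed : ∀ x → ClosedUnder L x D Derivable
    Derivable-closed x s d q _ h = derive s d q (⟦⟧⇒⟦⟧⁺ (disciplined s d D q) h)

    closure⊆Derivable : ∀ {x c} → IsClosure L x → X x c → Derivable c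
    closure⊆Derivable {x} {c} closure h =
      proj₂ (proj₁ (closure D c) h) Derivable (Derivable-closed x)

    closure-involves : ∀ {x c} → IsClosure L x → X x c →
                       InI L x (Conc.sign c) (Conc.tag c)
    closure-involves {x} {c} closure h = base (proj₁ (proj₁ (closure D c) h))

    module _ (m : Fin k → ℕ) (stratification : ClosureStratification L m)
             (strong-negation : StrongNegation L)
             (closures : ∀ x → IsClosure L x) where

      CoherentBelow : ℕ → Set
      CoherentBelow N = ∀ {c} → m (Conc.tag c) < N → Derivable c → Derivable (negC c) → ⊥

      coherent-below : ∀ N → CoherentBelow N
      coherent-below zero () _ _
      coherent-below (suc N) lt c∈ negc∈ = Derivable-least M M-closed c∈ lt negc∈
        where
        M : Conc k → Set
        M c = m (Conc.tag c) < suc N → Derivable (negC c) → ⊥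

        tag-below : ∀ {d q s' d'} → RefTag s' d' (cond ⊕ d D q) →
                    m d < suc N → m d' < suc N
        tag-below {d} {q} {s'} {d'} r = ≤-<-trans (proj₁ stratification ⊕ d s' d' (D , q , r))

        -- a closure referred to by the rule for +d only involves rules strictly below d
        closure-clash : ∀ {d q x} → RefSet x (cond ⊕ d D q) → m d < suc N →
                        ∀ c → X x c → X x (negC c) → ⊥
        closure-clash {d} {q} {x} r lt c a b =
          coherent-below N
            (<-≤-trans (proj₂ stratification ⊕ d x _ _ (D , q , r)
                          (closure-involves (closures x) a)) (≤-pred lt))
            (closure⊆Derivable (closures x) a) (closure⊆Derivable (closures x) b)

        M-closed : ∀ s d q → ⟦ cond s d D q ⟧⁺ M X → M (conc s d q)
        M-closed ⊕ d q h lt (derive ⊖ d q h') =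
          sneg-excludes (cond ⊕ d D q)
            (λ r p Mc → Mc (tag-below r lt))
            (λ r → closure-clash r lt)
            h (subst (λ φ → ⟦ φ ⟧⁺ Derivable X) (strong-negation d D q) h')
        M-closed ⊖ d q h lt (derive ⊕ d q h') =
          sneg-excludes (cond ⊕ d D q)
            (λ {s'} r p dc Mc → Mc (tag-below r lt)
               (subst (λ s → Derivable (conc s _ p)) (sym (flip-involutive s')) dc))
            (λ r → closure-clash r lt)
            h' (subst (λ φ → ⟦ φ ⟧⁺ M X) (strong-negation d D q) h)

WellDisciplined⇒Coherent : ∀ {k n} (L : Logic k n) → WellDisciplined L → ∀ x → Coherent L x
WellDisciplined⇒Coherent L ((m , stratification) , disciplined , strong-negation , closures-even)
                         x D d q (+dq∈X , -dq∈X) =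
  coherent-below disciplined m stratification strong-negation closures
    (suc (m d)) (n<1+n (m d))
    (closure⊆Derivable disciplined (closures x) +dq∈X)
    (closure⊆Derivable disciplined (closures x) -dq∈X)
  where
  open Derivation L D
  closures : ∀ x → IsClosure L x
  closures x = proj₁ (closures-even x)

proposition10 : ∀ {k n : ℕ} (L : Logic k n) → WellDisciplined L → WellBehaved L
proposition10 L wd@(_ , disciplined , strong-negation , closures-even) =
  stable , strong-negation , λ x → WellDisciplined⇒Coherent L wd x , closures-even x
  where
  stable : ∀ s d → Stable L s d
  stable s d D q P Q _ _ P⊆Q = PDisc-mono (disciplined s d D q) (Any-resp-⊆ P⊆Q)
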